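{- For all subfunctors of $1$ in $[\mathcal W^{op},\mathbf{Set}]$: (1) for every atom $p$, $\llbracket p\rrbracket_v$ is closed; (2) $1$ is closed; (3) if $U$ and $V$ are closed, so is $U\times V$; (4) if $U$ is closed and $W$ is any subfunctor of $1$, then $W\to U$ is closed; (5) an arbitrary product of closed subfunctors of $1$ is closed; (6) if $U$ and $V$ are closed, then the least closed subfunctor of $1$ containing both $U$ and $V$ is (the subfunctor of $1$ isomorphic to) $\prod_{p\in\mathbb A}(U\to\llbracket p\rrbracket_v)\to(V\to\llbracket p\rrbracket_v)\to\llbracket p\rrbracket_v$, which is therefore the join of $U$ and $V$ in $\Omega_K$; (7) $\Omega_K$ is a complete Heyting algebra.
   Context: Fix a countable set $\mathbb A$ of atoms. An atomic rule is $\mathcal R=((P_1\Rightarrow q_1),\dots,(P_n\Rightarrow q_n))\Rightarrow r$ with $n\ge0$, $P_i$ finite sets of atoms, $q_i,r$ atoms. A base is a countable set of atomic rules. A context $(X:P)$ is a finite list $x_1:p_1,\dots,x_m:p_m$. Derivation terms $\Phi::=x\mid\Phi_{\mathcal R}(\Phi_1,\dots,\Phi_n)$; derivations in base $\mathcal B$ generated by $(X:P),x:p\vdash_{\mathcal B}x:p$ and, for $\mathcal R\in\mathcal B$, from $(X:P),(X_i:P_i)\vdash_{\mathcal B}\Phi_i:q_i$ infer $(X:P)\vdash_{\mathcal B}\Phi_{\mathcal R}(\Phi_1,\dots,\Phi_n):r$. The category $\mathcal W$ has objects $(\mathcal B,(X:P))$; a morphism $(\mathcal B,(X:P))\to(\mathcal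 C,(Y:Q))$, $Y:Q=y_1:q_1,\dots,y_m:q_m$, exists only when $\mathcal C\subseteq\mathcal B$ and is a tuple of derivations $(X:P)\vdash_{\mathcal B}\Phi_i:q_i$; identities are variable tuples, composition is simultaneous substitution. In $[\mathcal W^{op},\mathbf{Set}]$, $1$ is the constant presheaf $\{*\}$, $\times$ is pointwise product and $F\to G$ the exponential ($(F\to G)(w)$ = natural transformations $\mathcal W(-,w)\times F\to G$); products and exponentials of subfunctors of $1$ are (isomorphic to) subfunctors of $1$. $\llbracket p\rrbracket(\mathcal B,(X:P))$ is the set of derivations $(X:P)\vdash_{\mathcal B}\Phi:p$ (action by substitution), and $\llbracket p\rrbracket_v$ is the subfunctor of $1$ with $\llbracket p\rrbracket_v(w)=\{*\}$ if $\llbracket p\rrbracket(w)\neq\emptyset$ and $\emptyset$ otherwise. For a subfunctor $U$ of $1$, $KU$ is the subfunctor of $1$ isomorphic to $\prod_{p\in\mathbb A}(U\to\llbracket p\rrbracket_v)\to\llbracket p\rrbracket_v$. $U$ is closed if $KU=U$; $\Omega_K$ is the set of closed subfunctors of $1$ ordered by pointwise inclusion. -}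

module Defs where

open import Data.Nat using (ℕ)
open import Data.Maybe using (Maybe; just)
open import Data.List using (List; _++_)
open import Data.List.Membership.Propositional using (_∈_)
open import Data.List.Relation.Unary.All using (All)
open import Data.Product using (Σ; _×_; _,_; proj₁; proj₂)
open import Data.Unit using (⊤)
open import Function.Definitions using (Injective)
open import Relation.Binary.PropositionalEquality using (_≡_)

Countable : Set → Set
Countable A = Σ (A → ℕ) λ f → Injective _≡_ _≡_ f

module Model (𝔸 : Set) where

  -- Atomic rule ((P₁ ⇒ q₁),…,(Pₙ ⇒ qₙ)) ⇒ r ; finite sets Pᵢ as lists.
  record Rule : Set where
    constructor rule
    field
      prems : List (List 𝔸 × 𝔸)
      concl : 𝔸
  open Rule public

  -- A base is a countable set of atomic rules, given by an enumeration
  -- (nothing at index n allowed, so finite and empty bases are included).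
  Base : Set
  Base = ℕ → Maybe Rule

  _∈B_ : Rule → Base → Set
  R ∈B B = Σ ℕ λ n → B n ≡ just R

  _⊆B_ : Base → Base → Set
  C ⊆B B = ∀ R → R ∈B C → R ∈B B

  -- Contexts: lists of atoms; variables are de Bruijn positions (p ∈ Γ).
  Ctx : Set
  Ctx = List 𝔸

  data Deriv (B : Base) (Γ : Ctx) : 𝔸 → Set where
    var : ∀ {p} → p ∈ Γ → Deriv B Γ p
    app : (R : Rule) → R ∈B B →
          All (λ Pq → Deriv B (Γ ++ proj₁ Pq) (proj₂ Pq)) (prems R) →
          Deriv B Γ (concl R)

  Obj : Set
  Obj = Base × Ctx

  Hom : Obj → Obj → Set
  Hom (B , Γ) (C , Δ) = (C ⊆B B) × All (Deriv B Γ) Δ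

  -- Subfunctors of 1 are represented by predicates on objects (a subfunctor
  -- is nonempty at w iff the predicate is inhabited) that are stable under
  -- the presheaf action.
  Pred : Set₁
  Pred = Obj → Set

  IsSub : Pred → Set
  IsSub U = ∀ {w w'} → Hom w' w → U w → U w'

  𝟙 : Pred
  𝟙 _ = ⊤

  _×ₚ_ : Pred → Pred → Pred
  (U ×ₚ V) w = U w × V w

  _⇒ₚ_ : Pred → Pred → Pred
  (U ⇒ₚ V) w = ∀ w' → Hom w' w → U w' → V w'
  infixr 5 _⇒ₚ_

  Πₚ : {I : Set} → (I → Pred) → Pred
  Πₚ U w = ∀ i → U i w

  -- ⟦ p ⟧_v : inhabited iff ⟦ p ⟧(w) ≠ ∅
  ⟦_⟧v : 𝔸 → Pred
  ⟦ p ⟧v (B , Γ) = Deriv B Γ p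

  K : Pred → Pred
  K U = Πₚ (λ p → (U ⇒ₚ ⟦ p ⟧v) ⇒ₚ ⟦ p ⟧v)

  _⊆ₚ_ : Pred → Pred → Set
  U ⊆ₚ V = ∀ w → U w → V w

  _≈ₚ_ : Pred → Pred → Set
  U ≈ₚ V = (U ⊆ₚ V) × (V ⊆ₚ U)

  Closed : Pred → Set
  Closed U = K U ≈ₚ U

  J : Pred → Pred → Pred
  J U V = Πₚ (λ p → (U ⇒ₚ ⟦ p ⟧v) ⇒ₚ (V ⇒ₚ ⟦ p ⟧v) ⇒ₚ ⟦ p ⟧v)

  record ΩK : Set₁ where
    constructor ωk
    field
      ∣_∣    : Pred
      sub    : IsSub ∣_∣
      closed : Closed ∣_∣
  open ΩK public

  _≤Ω_ : ΩK → ΩK → Set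
  a ≤Ω b = ∣ a ∣ ⊆ₚ ∣ b ∣

record IsCompleteHeytingAlgebra {C : Set₁} (_≤_ : C → C → Set) : Set₁ where
  field
    ⋁       : {I : Set} → (I → C) → C
    ⋁-upper : {I : Set} (f : I → C) (i : I) → f i ≤ ⋁ f
    ⋁-least : {I : Set} (f : I → C) (c : C) → (∀ i → f i ≤ c) → ⋁ f ≤ c
    ⋀       : {I : Set} → (I → C) → C
    ⋀-lower : {I : Set} (f : I → C) (i : I) → ⋀ f ≤ f i
    ⋀-great : {I : Set} (f : I → C) (c : C) → (∀ i → c ≤ f i) → c ≤ ⋀ f
    _∧_     : C → C → C
    ∧-lowerˡ : ∀ a b → (a ∧ b) ≤ a
    ∧-lowerʳ : ∀ a b → (a ∧ b) ≤ b
    ∧-great  : ∀ a b c → c ≤ a → c ≤ b → c ≤ (a ∧ b)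
    _⇨_     : C → C → C
    curry   : ∀ a b c → (a ∧ b) ≤ c → a ≤ (b ⇨ c)
    uncurry : ∀ a b c → a ≤ (b ⇨ c) → (a ∧ b) ≤ c

{-# OPTIONS --safe #-}
module Submission where

-- Closedness is preserved by products (K is monotone) and by exponentials W ⇒ U,
-- because K (W ⇒ U) ⊆ W ⇒ K U; the atoms ⟦ p ⟧v are closed outright. Since K U and
-- J U V are products of iterated exponentials into atoms, they are closed too, which
-- makes K idempotent and J U V the least closed subfunctor above U and V. In Ω_K,
-- meets and implications are then computed pointwise and joins are K of the union.

open import Defs
open import Data.Product using (_×_; Σ; _,_; proj₁; proj₂)
open import Data.Sum using (inj₁; inj₂)
open import Data.Unit using (tt)
open import Function using (_∘_)
open import Data.List using (List; _++_)
open import Data.List.Membership.Propositional using (_∈_)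
open import Data.List.Membership.Propositional.Properties using (∈-++⁺ˡ; ∈-++⁺ʳ; ∈-++⁻)
open import Data.List.Relation.Unary.All as All using (All; []; _∷_)

module Closure (𝔸 : Set) where
  open Model 𝔸

  Premises : Base → Ctx → List (List 𝔸 × 𝔸) → Set
  Premises B Γ = All (λ Pq → Deriv B (Γ ++ proj₁ Pq) (proj₂ Pq))

  Ren : Ctx → Ctx → Set
  Ren Γ Δ = ∀ {x} → x ∈ Γ → x ∈ Δ

  extendRen : ∀ {Γ Δ} P → Ren Γ Δ → Ren (Γ ++ P) (Δ ++ P)
  extendRen {Γ} {Δ} P ρ m with ∈-++⁻ Γ m
  ... | inj₁ m∈Γ = ∈-++⁺ˡ (ρ m∈Γ)
  ... | inj₂ m∈P = ∈-++⁺ʳ Δ m∈P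

  mutual
    rename : ∀ {B Γ Δ p} → Ren Γ Δ → Deriv B Γ p → Deriv B Δ p
    rename ρ (var m)      = var (ρ m)
    rename ρ (app R r ds) = app R r (renamePremises ρ ds)

    renamePremises : ∀ {B Γ Δ ps} → Ren Γ Δ → Premises B Γ ps → Premises B Δ ps
    renamePremises ρ []                     = []
    renamePremises ρ (_∷_ {x = P , _} d ds) = rename (extendRen P ρ) d ∷ renamePremises ρ ds

  Sub : Base → Ctx → Ctx → Set
  Sub B Γ Δ = ∀ {x} → x ∈ Γ → Deriv B Δ x

  extendSub : ∀ {B Γ Δ} P → Sub B Γ Δ → Sub B (Γ ++ P) (Δ ++ P)
  extendSub {Γ = Γ} {Δ} P σ m with ∈-++⁻ Γ m
  ... | inj₁ m∈Γ = rename ∈-++⁺ˡ (σ m∈Γ)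
  ... | inj₂ m∈P = var (∈-++⁺ʳ Δ m∈P)

  mutual
    subst : ∀ {B C Γ Δ p} → C ⊆B B → Sub B Γ Δ → Deriv C Γ p → Deriv B Δ p
    subst C⊆B σ (var m)      = σ m
    subst C⊆B σ (app R r ds) = app R (C⊆B R r) (substPremises C⊆B σ ds)

    substPremises : ∀ {B C Γ Δ ps} → C ⊆B B → Sub B Γ Δ → Premises C Γ ps → Premises B Δ ps
    substPremises C⊆B σ []                     = []
    substPremises C⊆B σ (_∷_ {x = P , _} d ds) =
      subst C⊆B (extendSub P σ) d ∷ substPremises C⊆B σ ds

  ⟦_⟧v-isSub : ∀ p → IsSub ⟦ p ⟧v
  ⟦ p ⟧v-isSub {_ , _} {_ , _} (C⊆B , σ) = subst C⊆B (All.lookup σ)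

  idHom : ∀ w → Hom w w
  idHom (_ , _) = (λ R r → r) , All.tabulate var

  compHom : ∀ {w₂ w₁ w₀} → Hom w₂ w₁ → Hom w₁ w₀ → Hom w₂ w₀
  compHom {_ , _} {_ , _} {_ , _} g (C⊆B , σ) =
    (λ R r → proj₁ g R (C⊆B R r)) , All.map (⟦ _ ⟧v-isSub g) σ

  ⇒ₚ-isSub : ∀ {U V} → IsSub (U ⇒ₚ V)
  ⇒ₚ-isSub h φ w'' h' = φ w'' (compHom h' h)

  Πₚ-isSub : ∀ {I} {U : I → Pred} → (∀ i → IsSub (U i)) → IsSub (Πₚ U)
  Πₚ-isSub sU h u i = sU i h (u i)

  ×ₚ-isSub : ∀ {U V} → IsSub U → IsSub V → IsSub (U ×ₚ V)
  ×ₚ-isSub sU sV h (u , v) = sU h u , sV h v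

  K-isSub : ∀ {U} → IsSub (K U)
  K-isSub = Πₚ-isSub (λ _ → ⇒ₚ-isSub)

  J-isSub : ∀ {U V} → IsSub (J U V)
  J-isSub = Πₚ-isSub (λ _ → ⇒ₚ-isSub)

  apply : ∀ {U V} w → (U ⇒ₚ V) w → U w → V w
  apply w φ = φ w (idHom w)

  ⇒ₚ-monoʳ : ∀ {W U V} → U ⊆ₚ V → (W ⇒ₚ U) ⊆ₚ (W ⇒ₚ V)
  ⇒ₚ-monoʳ U⊆V _ φ w' h x = U⊆V w' (φ w' h x)

  ⇒ₚ-antitoneˡ : ∀ {U V W} → U ⊆ₚ V → (V ⇒ₚ W) ⊆ₚ (U ⇒ₚ W)
  ⇒ₚ-antitoneˡ U⊆V _ φ w' h u = φ w' h (U⊆V w' u)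

  K-unit : ∀ {U} → IsSub U → U ⊆ₚ K U
  K-unit sU w u p w' h f = apply w' f (sU h u)

  K-mono : ∀ {U V} → U ⊆ₚ V → K U ⊆ₚ K V
  K-mono U⊆V w k p = ⇒ₚ-antitoneˡ (λ w' → ⇒ₚ-antitoneˡ U⊆V w') w (k p)

  Closed-intro : ∀ {U} → IsSub U → K U ⊆ₚ U → Closed U
  Closed-intro sU KU⊆U = KU⊆U , K-unit sU

  K-least : ∀ {U W} → Closed W → U ⊆ₚ W → K U ⊆ₚ W
  K-least (KW⊆W , _) U⊆W w k = KW⊆W w (K-mono U⊆W w k)

  K-⇒ₚ : ∀ {W U} → IsSub W → K (W ⇒ₚ U) ⊆ₚ (W ⇒ₚ K U)
  K-⇒ₚ sW w k w' h x p w'' h' f =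
    k p w'' (compHom h' h) (λ w₃ h₃ φ → f w₃ h₃ (apply w₃ φ (sW (compHom h₃ h') x)))

  ⟦_⟧v-closed : ∀ p → Closed ⟦ p ⟧v
  ⟦ p ⟧v-closed = Closed-intro ⟦ p ⟧v-isSub (λ w k → k p w (idHom w) (λ _ _ d → d))

  𝟙-closed : Closed 𝟙
  𝟙-closed = (λ _ _ → tt) , K-unit (λ _ _ → tt)

  ×ₚ-closed : ∀ {U V} → IsSub U → IsSub V → Closed U → Closed V → Closed (U ×ₚ V)
  ×ₚ-closed sU sV cU cV = Closed-intro (×ₚ-isSub sU sV)
    (λ w k → K-least cU (λ _ → proj₁) w k , K-least cV (λ _ → proj₂) w k)

  ⇒ₚ-closed : ∀ {U W} → IsSub W → Closed U → Closed (W ⇒ₚ U)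
  ⇒ₚ-closed sW (KU⊆U , _) = Closed-intro ⇒ₚ-isSub
    (λ w k → ⇒ₚ-monoʳ KU⊆U w (K-⇒ₚ sW w k))

  Πₚ-closed : ∀ {I} {U : I → Pred} → (∀ i → IsSub (U i)) → (∀ i → Closed (U i)) → Closed (Πₚ U)
  Πₚ-closed sU cU = Closed-intro (Πₚ-isSub sU) (λ w k i → K-least (cU i) (λ _ u → u i) w k)

  K-closed : ∀ {U} → Closed (K U)
  K-closed = Πₚ-closed (λ _ → ⇒ₚ-isSub) (λ p → ⇒ₚ-closed ⇒ₚ-isSub ⟦ p ⟧v-closed)

  J-closed : ∀ {U V} → Closed (J U V)
  J-closed = Πₚ-closed (λ _ → ⇒ₚ-isSub)
    (λ p → ⇒ₚ-closed ⇒ₚ-isSub (⇒ₚ-closed ⇒ₚ-isSub ⟦ p ⟧v-closed))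

  J-upperˡ : ∀ {U V} → IsSub U → U ⊆ₚ J U V
  J-upperˡ sU w u p w' h f w'' h' _ = f w'' h' (sU (compHom h' h) u)

  J-upperʳ : ∀ {U V} → IsSub V → V ⊆ₚ J U V
  J-upperʳ sV w v p w' h _ w'' h' g = apply w'' g (sV (compHom h' h) v)

  J-least : ∀ {U V W} → Closed W → U ⊆ₚ W → V ⊆ₚ W → J U V ⊆ₚ W
  J-least (KW⊆W , _) U⊆W V⊆W w j = KW⊆W w λ p w' h f →
    apply w' (j p w' h (⇒ₚ-antitoneˡ U⊆W w' f)) (⇒ₚ-antitoneˡ V⊆W w' f)

  ⋃ₚ : {I : Set} → (I → Pred) → Pred
  ⋃ₚ U w = Σ _ λ i → U i w

  ⋃ₚ-isSub : ∀ {I} {U : I → Pred} → (∀ i → IsSub (U i)) → IsSub (⋃ₚ U)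
  ⋃ₚ-isSub sU h (i , u) = i , sU i h u

  ΩK-isCompleteHeytingAlgebra : IsCompleteHeytingAlgebra _≤Ω_
  ΩK-isCompleteHeytingAlgebra = record
    { ⋁        = λ a → ωk (K (⋃ₚ (∣_∣ ∘ a))) K-isSub K-closed
    ; ⋁-upper  = λ a i w x → K-unit (⋃ₚ-isSub (sub ∘ a)) w (i , x)
    ; ⋁-least  = λ a c a≤c → K-least (closed c) (λ w (i , x) → a≤c i w x)
    ; ⋀        = λ a → ωk (Πₚ (∣_∣ ∘ a)) (Πₚ-isSub (sub ∘ a)) (Πₚ-closed (sub ∘ a) (closed ∘ a))
    ; ⋀-lower  = λ a i w x → x i
    ; ⋀-great  = λ a c c≤a w x i → c≤a i w x
    ; _∧_      = λ a b → ωk (∣ a ∣ ×ₚ ∣ b ∣) (×ₚ-isSub (sub a) (sub b))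
                            (×ₚ-closed (sub a) (sub b) (closed a) (closed b))
    ; ∧-lowerˡ = λ _ _ _ → proj₁
    ; ∧-lowerʳ = λ _ _ _ → proj₂
    ; ∧-great  = λ _ _ _ c≤a c≤b w x → c≤a w x , c≤b w x
    ; _⇨_      = λ a b → ωk (∣ a ∣ ⇒ₚ ∣ b ∣) ⇒ₚ-isSub (⇒ₚ-closed (sub a) (closed b))
    ; curry    = λ a _ _ a∧b≤c w x w' h y → a∧b≤c w' (sub a h x , y)
    ; uncurry  = λ _ _ _ a≤b⇨c w (x , y) → apply w (a≤b⇨c w x) y
    }

lemma19 : (𝔸 : Set) → Countable 𝔸 → let open Model 𝔸 in
    -- (1)
    (∀ p → Closed ⟦ p ⟧v)
    -- (2)
    × Closed 𝟙
    -- (3)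
    × (∀ U V → IsSub U → IsSub V → Closed U → Closed V → Closed (U ×ₚ V))
    -- (4)
    × (∀ U W → IsSub U → IsSub W → Closed U → Closed (W ⇒ₚ U))
    -- (5)
    × (∀ (I : Set) (U : I → Pred) → (∀ i → IsSub (U i)) → (∀ i → Closed (U i)) → Closed (Πₚ U))
    -- (6)
    × (∀ U V → IsSub U → IsSub V → Closed U → Closed V →
         IsSub (J U V) × Closed (J U V) × (U ⊆ₚ J U V) × (V ⊆ₚ J U V)
         × (∀ W → IsSub W → Closed W → U ⊆ₚ W → V ⊆ₚ W → J U V ⊆ₚ W))
    -- (7)
    × IsCompleteHeytingAlgebra _≤Ω_
lemma19 𝔸 _ =
    ⟦_⟧v-closed
  , 𝟙-closed
  , (λ _ _ → ×ₚ-closed)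
  , (λ _ _ _ sW → ⇒ₚ-closed sW)
  , (λ _ _ → Πₚ-closed)
  , (λ _ _ sU sV _ _ → J-isSub , J-closed , J-upperˡ sU , J-upperʳ sV , λ _ _ cW → J-least cW)
  , ΩK-isCompleteHeytingAlgebra
  where open Closure 𝔸
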